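{- Let $k\ge1$. A graph $F$ has a path decomposition of width at most $k$ if and only if it has a $k$-simplicial walk that is decomposing in $F$.
   Context: Graphs are finite and undirected. A path decomposition of $F$ is a pair $(P,\beta)$ with $P$ a path and $\beta:V(P)\to 2^{V(F)}$ such that (T1) every edge $uv\in E(F)$ has $u,v\in\beta(s)$ for some $s$, and (T2) for each $v\in V(F)$ the set $\{s:v\in\beta(s)\}$ induces a nonempty connected subgraph of $P$; its width is $\max_s|\beta(s)|-1$. A $k$-simplicial walk of length $t$ in $F$ is a sequence $(\beta_1,\dots,\beta_t)$ of subsets of $V(F)$ with $1\le|\beta_i|\le k+1$, $|\beta_1|=1$, and for each $i\in[t-1]$ a vertex $u$ with $\beta_{i+1}=\beta_i\sqcup\{u\}$ ($u$ incoming) or $\beta_i=\beta_{i+1}\sqcup\{u\}$ ($u$ outgoing). It is decomposing in $F$ if (D1) every vertex of $F$ is incoming exactly once in the walk (the element of $\beta_1$ counting as incoming at the start) and (D2) every edge $uv\in E(F)$ has $u,v\in\beta_i$ for some $i$. -}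

module Defs where

open import Level using (0ℓ)
open import Data.Nat using (ℕ; zero; suc; _+_; _≤_)
open import Data.Fin using (Fin; inject₁) renaming (_≤_ to _≤ᶠ_)
open import Data.Fin.Subset using (Subset; _∈_; _∉_; ∣_∣; _∪_; ⁅_⁆)
open import Data.Product using (Σ; ∃; _×_; ∃-syntax)
open import Data.Sum using (_⊎_)
open import Relation.Binary.PropositionalEquality using (_≡_)
open import Relation.Nullary using (¬_)

record Graph : Set₁ where
  field
    n      : ℕ
    Adj    : Fin n → Fin n → Set
    sym    : ∀ {u v} → Adj u v → Adj v u
    irrefl : ∀ {u} → ¬ Adj u u

open Graph public

-- A path decomposition (P, β) of F; the path P has m ≥ 1 vertices,
-- identified with Fin (suc m') in path order.
record PathDecomposition (F : Graph) : Set where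
  field
    len  : ℕ
    bag  : Fin (suc len) → Subset (n F)
    edge-covered : ∀ u v → Adj F u v → ∃[ s ] (u ∈ bag s × v ∈ bag s)
    vertex-occurs : ∀ v → ∃[ s ] (v ∈ bag s)
    -- (T2) connected in the path = an interval of indices
    vertex-interval : ∀ v (i j l : Fin (suc len)) →
      i ≤ᶠ l → l ≤ᶠ j → v ∈ bag i → v ∈ bag j → v ∈ bag l

WidthAtMost : {F : Graph} → ℕ → PathDecomposition F → Set
WidthAtMost k D = ∀ s → ∣ PathDecomposition.bag D s ∣ ≤ suc k

DisjAdd : {n : ℕ} → Subset n → Fin n → Subset n → Set
DisjAdd A u B = u ∉ A × B ≡ A ∪ ⁅ u ⁆

record SimplicialWalk (k n : ℕ) : Set where
  field
    t    : ℕ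
    β    : Fin (suc t) → Subset n
    size-pos : ∀ i → 1 ≤ ∣ β i ∣
    size-le  : ∀ i → ∣ β i ∣ ≤ suc k
    first-singleton : ∣ β Fin.zero ∣ ≡ 1
    step : ∀ (i : Fin t) → ∃[ u ]
      (DisjAdd (β (inject₁ i)) u (β (Fin.suc i)) ⊎ DisjAdd (β (Fin.suc i)) u (β (inject₁ i)))

  Incoming : Fin n → Fin (suc t) → Set
  Incoming v Fin.zero    = v ∈ β Fin.zero
  Incoming v (Fin.suc i) = DisjAdd (β (inject₁ i)) v (β (Fin.suc i))

Decomposing : {k : ℕ} (F : Graph) → SimplicialWalk k (n F) → Set
Decomposing F W =
  (∀ v → ∃[ i ] (Incoming v i × (∀ j → Incoming v j → j ≡ i)))
  × (∀ u v → Adj F u v → ∃[ i ] (u ∈ β i × v ∈ β i))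
  where open SimplicialWalk W

{-# OPTIONS --safe #-}
-- Along a walk, a vertex v is incoming exactly where its membership sequence [v ∈ β₁], [v ∈ β₂], …
-- rises (from 0, or at the start, to 1).  So (D1) says that each membership sequence has exactly one
-- rise, i.e. is a nonempty interval, and the sets of a decomposing walk are the bags of a path
-- decomposition of the same width.
--
-- Conversely, drop the empty bags and join consecutive bags C, B by deleting the vertices of C ∖ B
-- one at a time and then adding those of B ∖ C; when C ∩ B = ∅ the walk goes through {x, y} with
-- x ∈ C and y ∈ B, which is where k ≥ 1 is needed.  Along such a segment each membership sequence
-- has the form c…c b…b, with c and b the memberships in C and B.  Being an interval is recognised
-- by a four-state automaton whose transitions are idempotent, so it cannot tell such a segment from
-- the two letters c b, and the walk inherits the interval property from the decomposition.

module Submission where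

open import Defs hiding (sym)
open import Data.Bool as Bool using (Bool; true; false)
open import Data.Bool.Properties using (¬-not; ∨-zeroʳ; ∨-identityʳ)
open import Data.Empty using (⊥-elim)
open import Data.Fin using (Fin; zero; suc; inject₁; fromℕ<; _≟_)
  renaming (_≤_ to _≤ᶠ_; _<_ to _<ᶠ_)
open import Data.Fin.Properties using (<-cmp; <⇒≤pred; ≤̄⇒inject₁<)
open import Data.Fin.Subset using (Subset; _∈_; _∉_; _⊆_; _∪_; _∩_; ⁅_⁆; ∣_∣; Nonempty)
open import Data.Fin.Subset.Properties
  using ( _∈?_; nonempty?; ∪-identityʳ; ∣p∣≤∣x∷p∣; p⊆q⇒∣p∣≤∣q∣; p∩q⊆p; p∩q⊆q
        ; x∈p∩q⁺; x∈p∪q⁺; x∈p∪q⁻; x∈⁅x⁆; x∈⁅y⁆⇒x≡y; ∣⁅x⁆∣≡1)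
open import Data.List as List using (List; []; _∷_; _++_; foldl; tabulate; allFin; length; lookup; filter)
open import Data.List.Properties using (foldl-++; map-++; map-tabulate; tabulate-lookup)
open import Data.List.Relation.Unary.All as All using (All; []; _∷_)
import Data.List.Relation.Unary.All.Properties as All
open import Data.List.Relation.Unary.Any as Any using (here; there)
open import Data.List.Relation.Unary.Any.Properties using (lookup-index)
open import Data.List.Membership.Propositional using () renaming (_∈_ to _∈ˡ_)
open import Data.List.Membership.Propositional.Properties using (∈-allFin; ∈-lookup; ∈-tabulate⁺; ∈-filter⁺)
open import Data.Nat as ℕ using (ℕ; suc; _≤_; _+_; z≤n; s≤s)
import Data.Nat.Properties as ℕ
open import Data.Product using (Σ-syntax; ∃; ∃-syntax; _×_; _,_; proj₁; proj₂)
open import Data.Sum as Sum using (_⊎_; inj₁; inj₂; [_,_])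
open import Data.Vec as Vec using ([]; _∷_; _[_]≔_)
open import Data.Vec.Properties
  using ( tabulate∘lookup; tabulate-cong; []=⇒lookup; lookup⇒[]=
        ; lookup∘update; lookup∘update′; []≔-idempotent; []≔-lookup)
open import Function using (_∘_; id)
open import Function.Bundles using (_⇔_; mk⇔)
open import Relation.Binary.Construct.Closure.ReflexiveTransitive using (Star; ε; _◅_; _◅◅_)
open import Relation.Binary.Definitions using (tri<; tri≈; tri>)
open import Relation.Binary.PropositionalEquality
  using (_≡_; _≢_; refl; sym; trans; subst; subst₂; cong; cong₂; module ≡-Reasoning)
open import Relation.Nullary using (¬_; contradiction; yes; no)

-- Intervals and rises of Boolean sequences

Interval : ∀ {m} → (Fin m → Bool) → Set
Interval f = ∀ i j l → i ≤ᶠ l → l ≤ᶠ j → f i ≡ true → f j ≡ true → f l ≡ true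

Rise : ∀ {m} → (Fin m → Bool) → Fin m → Set
Rise f zero    = f zero ≡ true
Rise f (suc i) = f (inject₁ i) ≡ false × f (suc i) ≡ true

rise⇒true : ∀ {m} (f : Fin m → Bool) i → Rise f i → f i ≡ true
rise⇒true f zero    r = r
rise⇒true f (suc i) r = proj₂ r

rise-suc : ∀ {m} (f : Fin (ℕ.suc m) → Bool) i → f zero ≡ false → Rise (f ∘ suc) i → Rise f (suc i)
rise-suc f zero    f₀ r = f₀ , r
rise-suc f (suc i) f₀ r = r

rise-at-or-before : ∀ {m} (f : Fin m → Bool) i → f i ≡ true → ∃[ r ] (r ≤ᶠ i × Rise f r)
rise-at-or-before f zero    fi = zero , z≤n , fi
rise-at-or-before f (suc i) fi with f zero in f₀
... | true  = zero , z≤n , f₀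
... | false with rise-at-or-before (f ∘ suc) i fi
...   | r , r≤i , rise = suc r , s≤s r≤i , rise-suc f r f₀ rise

rise-after : ∀ {m} (f : Fin m → Bool) l j → f l ≡ false → f j ≡ true → l ≤ᶠ j →
             ∃[ r ] (l <ᶠ r × Rise f r)
rise-after f zero    zero    fl fj _ with () ← trans (sym fl) fj
rise-after f zero    (suc j) fl fj _ with rise-at-or-before (f ∘ suc) j fj
... | r , _ , rise = suc r , s≤s z≤n , rise-suc f r fl rise
rise-after f (suc l) (suc j) fl fj (s≤s l≤j) with rise-after (f ∘ suc) l j fl fj l≤j
... | suc r , l<r , rise = suc (suc r) , s≤s l<r , rise

no-later-rise : ∀ {m} (f : Fin m → Bool) → Interval f → ∀ i j → i <ᶠ j → Rise f i → ¬ Rise f j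
no-later-rise f int i (suc j) i<j ri (fj₋₁ , fj)
  with () ← trans (sym (int i (suc j) (inject₁ j) (<⇒≤pred i<j) (ℕ.<⇒≤ (≤̄⇒inject₁< ℕ.≤-refl))
                             (rise⇒true f i ri) fj)) fj₋₁

interval⇒unique-rise : ∀ {m} (f : Fin m → Bool) → Interval f → ∀ i j → Rise f i → Rise f j → i ≡ j
interval⇒unique-rise f int i j ri rj with <-cmp i j
... | tri< i<j _ _ = ⊥-elim (no-later-rise f int i j i<j ri rj)
... | tri≈ _ i≡j _ = i≡j
... | tri> _ _ j<i = ⊥-elim (no-later-rise f int j i j<i rj ri)

unique-rise⇒interval : ∀ {m} (f : Fin m → Bool) → (∀ i j → Rise f i → Rise f j → i ≡ j) → Interval f
unique-rise⇒interval f unique i j l i≤l l≤j fi fj with f l in fl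
... | true  = refl
... | false with rise-at-or-before f i fi | rise-after f l j fl fj l≤j
...   | r , r≤i , rise | r′ , l<r′ , rise′ with refl ← unique r r′ rise rise′ =
  ⊥-elim (ℕ.<-irrefl refl (ℕ.≤-<-trans (ℕ.≤-trans r≤i i≤l) l<r′))

-- An automaton recognising intervals

-- run before w ≢ dead iff the trues of w are consecutive: before = only falses read so far,
-- inside = in the block of trues, after = past it.
data Phase : Set where
  before inside after dead : Phase

next : Phase → Bool → Phase
next before false = before
next before true  = inside
next inside false = after
next inside true  = inside
next after  false = after
next after  true  = dead
next dead   _     = dead

run : Phase → List Bool → Phase
run = foldl next

Survives : Phase → List Bool → Set
Survives s w = run s w ≢ dead

next-idem : ∀ s b → next (next s b) b ≡ next s b
next-idem before false = refl
next-idem before true  = refl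
next-idem inside false = refl
next-idem inside true  = refl
next-idem after  false = refl
next-idem after  true  = refl
next-idem dead   _     = refl

run-dead : ∀ w → run dead w ≡ dead
run-dead []      = refl
run-dead (_ ∷ w) = run-dead w

¬survives-after-true : ∀ w → ¬ Survives after (true ∷ w)
¬survives-after-true w ok = ok (run-dead w)

DownClosed : ∀ {m} → (Fin m → Bool) → Set
DownClosed f = ∀ l j → l ≤ᶠ j → f j ≡ true → f l ≡ true

false⇒survives-after : ∀ {m} (f : Fin m → Bool) → (∀ i → f i ≡ false) → Survives after (tabulate f)
false⇒survives-after {ℕ.zero}  f _ ()
false⇒survives-after {ℕ.suc m} f f≡false rewrite f≡false zero = false⇒survives-after (f ∘ suc) (f≡false ∘ suc)

downClosed⇒survives-inside : ∀ {m} (f : Fin m → Bool) → DownClosed f → Survives inside (tabulate f)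
downClosed⇒survives-inside {ℕ.zero}  f _ ()
downClosed⇒survives-inside {ℕ.suc m} f down with f zero in f₀
... | true  = downClosed⇒survives-inside (f ∘ suc) (λ l j l≤j → down (suc l) (suc j) (s≤s l≤j))
... | false = false⇒survives-after (f ∘ suc) λ i →
                ¬-not λ fi → contradiction (trans (sym (down zero (suc i) z≤n fi)) f₀) λ ()

interval⇒survives-before : ∀ {m} (f : Fin m → Bool) → Interval f → Survives before (tabulate f)
interval⇒survives-before {ℕ.zero}  f _ ()
interval⇒survives-before {ℕ.suc m} f int with f zero in f₀
... | true  = downClosed⇒survives-inside (f ∘ suc) λ l j l≤j fj →
                int zero (suc j) (suc l) z≤n (s≤s l≤j) f₀ fj
... | false = interval⇒survives-before (f ∘ suc) λ i j l i≤l l≤j →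
                int (suc i) (suc j) (suc l) (s≤s i≤l) (s≤s l≤j)

survives-after⇒false : ∀ {m} (f : Fin m → Bool) → Survives after (tabulate f) → ∀ i → f i ≡ false
survives-after⇒false f ok zero with f zero
... | true  = ⊥-elim (¬survives-after-true (tabulate (f ∘ suc)) ok)
... | false = refl
survives-after⇒false f ok (suc i) with f zero
... | true  = ⊥-elim (¬survives-after-true (tabulate (f ∘ suc)) ok)
... | false = survives-after⇒false (f ∘ suc) ok i

survives-inside⇒downClosed : ∀ {m} (f : Fin m → Bool) → Survives inside (tabulate f) → DownClosed f
survives-inside⇒downClosed f ok zero    zero    _         fj = fj
survives-inside⇒downClosed f ok zero    (suc j) _         fj with f zero
... | true  = refl
... | false = contradiction (trans (sym fj) (survives-after⇒false (f ∘ suc) ok j)) λ ()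
survives-inside⇒downClosed f ok (suc l) (suc j) (s≤s l≤j) fj with f zero
... | true  = survives-inside⇒downClosed (f ∘ suc) ok l j l≤j fj
... | false = contradiction (trans (sym fj) (survives-after⇒false (f ∘ suc) ok j)) λ ()

survives-before⇒interval : ∀ {m} (f : Fin m → Bool) → Survives before (tabulate f) → Interval f
survives-before⇒interval f ok zero    j       zero    _         _         fi fj = fi
survives-before⇒interval f ok zero    (suc j) (suc l) _         (s≤s l≤j) fi fj =
  survives-inside⇒downClosed (f ∘ suc) (subst (λ b → Survives (next before b) (tabulate (f ∘ suc))) fi ok)
    l j l≤j fj
survives-before⇒interval f ok (suc i) (suc j) (suc l) (s≤s i≤l) (s≤s l≤j) fi fj with f zero
... | true  = survives-inside⇒downClosed (f ∘ suc) ok l j l≤j fj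
... | false = survives-before⇒interval (f ∘ suc) ok i j l i≤l l≤j fi fj

survives-after⇒inside : ∀ w → Survives after w → Survives inside w
survives-after⇒inside []          _  = λ ()
survives-after⇒inside (false ∷ w) ok = ok
survives-after⇒inside (true ∷ w)  ok = ⊥-elim (¬survives-after-true w ok)

survives-∷false⁻ : ∀ s w → Survives s (false ∷ w) → Survives s w
survives-∷false⁻ before w ok = ok
survives-∷false⁻ inside w ok = survives-after⇒inside w ok
survives-∷false⁻ after  w ok = ok
survives-∷false⁻ dead   w ok = ⊥-elim (ok (run-dead w))

survives-before-prepend : ∀ c b w → (c ≡ true → b ≡ true) →
                          Survives before (b ∷ w) → Survives before (c ∷ b ∷ w)
survives-before-prepend false b w _   ok = ok
survives-before-prepend true  b w c⇒b ok rewrite c⇒b refl = ok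

infix 4 _≈_

_≈_ : List Bool → List Bool → Set
w ≈ w′ = ∀ s → run s w ≡ run s w′

≈-++ʳ : ∀ {w w′} u → w ≈ w′ → w ++ u ≈ w′ ++ u
≈-++ʳ {w} {w′} u w≈w′ s = begin
  run s (w ++ u)     ≡⟨ foldl-++ next s w u ⟩
  run (run s w) u    ≡⟨ cong (λ s′ → run s′ u) (w≈w′ s) ⟩
  run (run s w′) u   ≡⟨ foldl-++ next s w′ u ⟨
  run s (w′ ++ u)    ∎
  where open ≡-Reasoning

stutter : ∀ c t b → t ≡ c ⊎ t ≡ b → c ∷ t ∷ b ∷ [] ≈ c ∷ b ∷ []
stutter c .c b  (inj₁ refl) s = cong (λ s′ → next s′ b) (next-idem s c)
stutter c t  .t (inj₂ refl) s = next-idem (next s c) t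

-- Sets of vertices as bit vectors

[]≔true≡∪⁅⁆ : ∀ {n} (Y : Subset n) x → Y [ x ]≔ true ≡ Y ∪ ⁅ x ⁆
[]≔true≡∪⁅⁆ (b ∷ Y) zero    = cong₂ Vec._∷_ (sym (∨-zeroʳ b)) (sym (∪-identityʳ Y))
[]≔true≡∪⁅⁆ (b ∷ Y) (suc x) = cong₂ Vec._∷_ (sym (∨-identityʳ b)) ([]≔true≡∪⁅⁆ Y x)

∣p∪q∣≤∣p∣+∣q∣ : ∀ {n} (p q : Subset n) → ∣ p ∪ q ∣ ≤ ∣ p ∣ + ∣ q ∣
∣p∪q∣≤∣p∣+∣q∣ []          []         = z≤n
∣p∪q∣≤∣p∣+∣q∣ (true  ∷ p) (b ∷ q)    =
  s≤s (ℕ.≤-trans (∣p∪q∣≤∣p∣+∣q∣ p q) (ℕ.+-monoʳ-≤ ∣ p ∣ (∣p∣≤∣x∷p∣ b q)))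
∣p∪q∣≤∣p∣+∣q∣ (false ∷ p) (true ∷ q)  =
  ℕ.≤-trans (s≤s (∣p∪q∣≤∣p∣+∣q∣ p q)) (ℕ.≤-reflexive (sym (ℕ.+-suc ∣ p ∣ ∣ q ∣)))
∣p∪q∣≤∣p∣+∣q∣ (false ∷ p) (false ∷ q) = ∣p∪q∣≤∣p∣+∣q∣ p q

nonempty⇒∣p∣≥1 : ∀ {n} {X : Subset n} → Nonempty X → 1 ≤ ∣ X ∣
nonempty⇒∣p∣≥1 {X = X} (x , x∈X) =
  subst (_≤ ∣ X ∣) (∣⁅x⁆∣≡1 x) (p⊆q⇒∣p∣≤∣q∣ λ v∈⁅x⁆ → subst (_∈ X) (sym (x∈⁅y⁆⇒x≡y x v∈⁅x⁆)) x∈X)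

module _ {n : ℕ} where

  infix 7 _∈ᵇ_
  infix 4 _≃_

  _∈ᵇ_ : Fin n → Subset n → Bool
  v ∈ᵇ X = Vec.lookup X v

  ∈⇒∈ᵇ : ∀ {v X} → v ∈ X → v ∈ᵇ X ≡ true
  ∈⇒∈ᵇ = []=⇒lookup

  ∈ᵇ⇒∈ : ∀ {v X} → v ∈ᵇ X ≡ true → v ∈ X
  ∈ᵇ⇒∈ {v} {X} = lookup⇒[]= v X

  ∉⇒∈ᵇ≡false : ∀ {v X} → v ∉ X → v ∈ᵇ X ≡ false
  ∉⇒∈ᵇ≡false v∉X = ¬-not (v∉X ∘ ∈ᵇ⇒∈)

  ∈ᵇ≡false⇒∉ : ∀ {v X} → v ∈ᵇ X ≡ false → v ∉ X
  ∈ᵇ≡false⇒∉ v∉X v∈X with () ← trans (sym (∈⇒∈ᵇ v∈X)) v∉X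

  agree⇒≡ : ∀ {Y T} → (∀ v → v ∈ᵇ Y ≡ v ∈ᵇ T) → Y ≡ T
  agree⇒≡ {Y} {T} agree = trans (sym (tabulate∘lookup Y)) (trans (tabulate-cong agree) (tabulate∘lookup T))

  word : Fin n → List (Subset n) → List Bool
  word v = List.map (v ∈ᵇ_)

  word≡tabulate : ∀ v (Xs : List (Subset n)) → word v Xs ≡ tabulate (λ i → v ∈ᵇ lookup Xs i)
  word≡tabulate v Xs = trans (cong (word v) (sym (tabulate-lookup Xs))) (map-tabulate (lookup Xs) (v ∈ᵇ_))

  survives-filter-nonempty : ∀ s v (Xs : List (Subset n)) →
                             Survives s (word v Xs) → Survives s (word v (filter nonempty? Xs))
  survives-filter-nonempty s v []       ok = ok
  survives-filter-nonempty s v (X ∷ Xs) ok with nonempty? X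
  ... | yes _   = survives-filter-nonempty (next s (v ∈ᵇ X)) v Xs ok
  ... | no  X=∅ = survives-filter-nonempty s v Xs (survives-∷false⁻ s (word v Xs) ok′)
    where
      ok′ = subst (λ b → Survives s (b ∷ word v Xs)) (∉⇒∈ᵇ≡false λ v∈X → X=∅ (v , v∈X)) ok

  record _≃_ (Xs Ys : List (Subset n)) : Set where
    constructor mk≃
    field
      word-≈ : ∀ v → word v Xs ≈ word v Ys

  ≃-trans : ∀ {Xs Ys Zs} → Xs ≃ Ys → Ys ≃ Zs → Xs ≃ Zs
  ≃-trans (mk≃ p) (mk≃ q) = mk≃ λ v s → trans (p v s) (q v s)

  ≃-∷ : ∀ {Xs Ys} X → Xs ≃ Ys → X ∷ Xs ≃ X ∷ Ys
  ≃-∷ X (mk≃ p) = mk≃ λ v s → p v (next s (v ∈ᵇ X))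

  ≃-++ʳ : ∀ {Xs Ys} Zs → Xs ≃ Ys → Xs ++ Zs ≃ Ys ++ Zs
  ≃-++ʳ {Xs} {Ys} Zs (mk≃ p) = mk≃ λ v s → begin
    run s (word v (Xs ++ Zs))        ≡⟨ cong (run s) (map-++ (v ∈ᵇ_) Xs Zs) ⟩
    run s (word v Xs ++ word v Zs)   ≡⟨ ≈-++ʳ {word v Xs} {word v Ys} (word v Zs) (p v) s ⟩
    run s (word v Ys ++ word v Zs)   ≡⟨ cong (run s) (map-++ (v ∈ᵇ_) Ys Zs) ⟨
    run s (word v (Ys ++ Zs))        ∎
    where open ≡-Reasoning

  ≃-dup : ∀ X → X ∷ [] ≃ X ∷ X ∷ []
  ≃-dup X = mk≃ λ v s → sym (next-idem s (v ∈ᵇ X))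

  ≃-survives : ∀ {Xs Ys} s v → Xs ≃ Ys → Survives s (word v Ys) → Survives s (word v Xs)
  ≃-survives s v (mk≃ p) ok = ok ∘ trans (sym (p v s))

  Between : Subset n → Subset n → Subset n → Set
  Between C T B = (∀ {v} → v ∈ C → v ∈ B → v ∈ T) × (∀ {v} → v ∈ T → v ∈ C ⊎ v ∈ B)

  between⇒agrees : ∀ {C T B} → Between C T B → ∀ v → v ∈ᵇ T ≡ v ∈ᵇ C ⊎ v ∈ᵇ T ≡ v ∈ᵇ B
  between⇒agrees (C∩B⊆T , T⊆C∪B) v with v ∈? _ | v ∈? _
  ... | yes v∈T | _ with T⊆C∪B v∈T
  ...   | inj₁ v∈C = inj₁ (trans (∈⇒∈ᵇ v∈T) (sym (∈⇒∈ᵇ v∈C)))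
  ...   | inj₂ v∈B = inj₂ (trans (∈⇒∈ᵇ v∈T) (sym (∈⇒∈ᵇ v∈B)))
  between⇒agrees (C∩B⊆T , T⊆C∪B) v | no v∉T | no v∉C =
    inj₁ (trans (∉⇒∈ᵇ≡false v∉T) (sym (∉⇒∈ᵇ≡false v∉C)))
  between⇒agrees (C∩B⊆T , T⊆C∪B) v | no v∉T | yes v∈C =
    inj₂ (trans (∉⇒∈ᵇ≡false v∉T) (sym (∉⇒∈ᵇ≡false (v∉T ∘ C∩B⊆T v∈C))))

  between⇒≃ : ∀ {C T B} → Between C T B → C ∷ T ∷ B ∷ [] ≃ C ∷ B ∷ []
  between⇒≃ btw = mk≃ λ v → stutter _ _ _ (between⇒agrees btw v)

  Step : Subset n → Subset n → Set
  Step A B = ∃[ u ] (DisjAdd A u B ⊎ DisjAdd B u A)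

  update-step : ∀ {Y x b} → x ∈ᵇ Y ≢ b → Step Y (Y [ x ]≔ b)
  update-step {Y} {x} {true}  Yx≢true  = x , inj₁ (∈ᵇ≡false⇒∉ (¬-not Yx≢true) , []≔true≡∪⁅⁆ Y x)
  update-step {Y} {x} {false} Yx≢false = x , inj₂ (∈ᵇ≡false⇒∉ (lookup∘update x Y false) , Y≡Y-x∪⁅x⁆)
    where
      open ≡-Reasoning
      Y≡Y-x∪⁅x⁆ : Y ≡ (Y [ x ]≔ false) ∪ ⁅ x ⁆
      Y≡Y-x∪⁅x⁆ = begin
        Y                             ≡⟨ []≔-lookup Y x ⟨
        Y [ x ]≔ x ∈ᵇ Y               ≡⟨ cong (Y [ x ]≔_) (¬-not Yx≢false) ⟩
        Y [ x ]≔ true                 ≡⟨ []≔-idempotent Y x ⟨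
        (Y [ x ]≔ false) [ x ]≔ true  ≡⟨ []≔true≡∪⁅⁆ (Y [ x ]≔ false) x ⟩
        (Y [ x ]≔ false) ∪ ⁅ x ⁆      ∎

  update-between : ∀ Y T x → Between Y (Y [ x ]≔ x ∈ᵇ T) T
  update-between Y T x = Y∩T⊆Y′ , Y′⊆Y∪T
    where
      Y∩T⊆Y′ : ∀ {v} → v ∈ Y → v ∈ T → v ∈ Y [ x ]≔ x ∈ᵇ T
      Y∩T⊆Y′ {v} v∈Y v∈T with v ≟ x
      ... | yes refl = ∈ᵇ⇒∈ (trans (lookup∘update v Y _) (∈⇒∈ᵇ v∈T))
      ... | no v≢x   = ∈ᵇ⇒∈ (trans (lookup∘update′ v≢x Y _) (∈⇒∈ᵇ v∈Y))
      Y′⊆Y∪T : ∀ {v} → v ∈ Y [ x ]≔ x ∈ᵇ T → v ∈ Y ⊎ v ∈ T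
      Y′⊆Y∪T {v} v∈Y′ with v ≟ x
      ... | yes refl = inj₂ (∈ᵇ⇒∈ (trans (sym (lookup∘update v Y _)) (∈⇒∈ᵇ v∈Y′)))
      ... | no v≢x   = inj₁ (∈ᵇ⇒∈ (trans (sym (lookup∘update′ v≢x Y _)) (∈⇒∈ᵇ v∈Y′)))

-- Walks through a sequence of bags

module _ (k : ℕ) {n : ℕ} where

  Fits : Subset n → Set
  Fits X = Nonempty X × ∣ X ∣ ≤ suc k

  Move : Subset n → Subset n → Set
  Move C X = Step C X × Fits X

  visits : ∀ {C B} → Star Move C B → List (Subset n)
  visits ε                 = []
  visits (_◅_ {j = X} _ p) = X ∷ visits p

  visits-◅◅ : ∀ {C T B} (p : Star Move C T) (q : Star Move T B) →
              C ∷ visits (p ◅◅ q) ≡ (C ∷ visits p) ++ visits q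
  visits-◅◅     ε       q = refl
  visits-◅◅ {C} (_ ◅ p) q = cong (C ∷_) (visits-◅◅ p q)

  ∈-◅◅ : ∀ {C T B X} (p : Star Move C T) {q : Star Move T B} →
         X ∈ˡ T ∷ visits q → X ∈ˡ C ∷ visits (p ◅◅ q)
  ∈-◅◅ ε       X∈ = X∈
  ∈-◅◅ (_ ◅ p) X∈ = there (∈-◅◅ p X∈)

  ≃-◅◅ : ∀ {C T B Ws} (p : Star Move C T) (q : Star Move T B) →
         C ∷ visits p ≃ C ∷ T ∷ [] → T ∷ visits q ≃ T ∷ Ws → C ∷ visits (p ◅◅ q) ≃ C ∷ T ∷ Ws
  ≃-◅◅ {C} p q p≃ q≃ rewrite visits-◅◅ p q = ≃-trans (≃-++ʳ (visits q) p≃) (≃-∷ C q≃)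

  record Segment (C B : Subset n) : Set where
    field
      path   : Star Move C B
      ≃-ends : C ∷ visits path ≃ C ∷ B ∷ []

  open Segment

  stay : ∀ C → Segment C C
  stay C = record { path = ε ; ≃-ends = ≃-dup C }

  move : ∀ {C X} → Move C X → Segment C X
  move m = record { path = m ◅ ε ; ≃-ends = mk≃ λ _ _ → refl }

  _⨾⟨_⟩_ : ∀ {C T B} → Segment C T → Between C T B → Segment T B → Segment C B
  σ ⨾⟨ btw ⟩ τ = record
    { path   = path σ ◅◅ path τ
    ; ≃-ends = ≃-trans (≃-◅◅ (path σ) (path τ) (≃-ends σ) (≃-ends τ)) (between⇒≃ btw)
    }

  -- Flips the coordinates where Y and T differ, in the order of xs.  Every intermediate set lies
  -- between Y and T, so it still contains z and stays inside U.
  toward : ∀ {U} (xs : List (Fin n)) {Y T z} → (∀ v → v ∈ᵇ Y ≢ v ∈ᵇ T → v ∈ˡ xs) →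
           z ∈ Y → z ∈ T → Y ⊆ U → T ⊆ U → ∣ U ∣ ≤ suc k → Segment Y T
  toward [] {Y} {T} listed _ _ _ _ _ = subst (Segment Y) (agree⇒≡ agree) (stay Y)
    where
      agree : ∀ v → v ∈ᵇ Y ≡ v ∈ᵇ T
      agree v with v ∈ᵇ Y Bool.≟ v ∈ᵇ T
      ... | yes same = same
      ... | no differ with () ← listed v differ
  toward {U} (x ∷ xs) {Y} {T} {z} listed z∈Y z∈T Y⊆U T⊆U ∣U∣≤ with x ∈ᵇ Y Bool.≟ x ∈ᵇ T
  ... | yes same = toward xs listed′ z∈Y z∈T Y⊆U T⊆U ∣U∣≤
    where
      listed′ : ∀ v → v ∈ᵇ Y ≢ v ∈ᵇ T → v ∈ˡ xs
      listed′ v differ with listed v differ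
      ... | here refl  = ⊥-elim (differ same)
      ... | there v∈xs = v∈xs
  ... | no differ =
        move (update-step differ , (z , z∈Y′) , ℕ.≤-trans (p⊆q⇒∣p∣≤∣q∣ Y′⊆U) ∣U∣≤)
          ⨾⟨ update-between Y T x ⟩
        toward xs listed′ z∈Y′ z∈T Y′⊆U T⊆U ∣U∣≤
    where
      Y′ = Y [ x ]≔ x ∈ᵇ T
      z∈Y′ : z ∈ Y′
      z∈Y′ = proj₁ (update-between Y T x) z∈Y z∈T
      Y′⊆U : Y′ ⊆ U
      Y′⊆U v∈Y′ = [ Y⊆U , T⊆U ] (proj₂ (update-between Y T x) v∈Y′)
      listed′ : ∀ v → v ∈ᵇ Y′ ≢ v ∈ᵇ T → v ∈ˡ xs
      listed′ v differ′ with v ≟ x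
      ... | yes refl = ⊥-elim (differ′ (lookup∘update v Y _))
      ... | no v≢x with listed v (differ′ ∘ trans (lookup∘update′ v≢x Y _))
      ...   | here v≡x   = ⊥-elim (v≢x v≡x)
      ...   | there v∈xs = v∈xs

  segment-via-meet : ∀ {C B z} → Fits C → Fits B → z ∈ C ∩ B → Segment C B
  segment-via-meet {C} {B} (_ , ∣C∣≤) (_ , ∣B∣≤) z∈C∩B =
    toward (allFin n) (λ v _ → ∈-allFin v) (p∩q⊆p C B z∈C∩B) z∈C∩B id (p∩q⊆p C B) ∣C∣≤
      ⨾⟨ (λ v∈C v∈B → x∈p∩q⁺ (v∈C , v∈B)) , inj₁ ∘ p∩q⊆p C B ⟩
    toward (allFin n) (λ v _ → ∈-allFin v) z∈C∩B (p∩q⊆q C B z∈C∩B) (p∩q⊆q C B) id ∣B∣≤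

  segment : 1 ≤ k → ∀ {C B} → Fits C → Fits B → Segment C B
  segment k≥1 {C} {B} fits-C@((x , x∈C) , _) fits-B@((y , y∈B) , _) with nonempty? (C ∩ B)
  ... | yes (_ , z∈C∩B) = segment-via-meet fits-C fits-B z∈C∩B
  ... | no disjoint =
        segment-via-meet fits-C fits-M (x∈p∩q⁺ (x∈C , x∈M))
          ⨾⟨ C∩B⊆M , M⊆C∪B ⟩
        segment-via-meet fits-M fits-B (x∈p∩q⁺ (y∈M , y∈B))
    where
      M = ⁅ x ⁆ ∪ ⁅ y ⁆
      x∈M = x∈p∪q⁺ (inj₁ (x∈⁅x⁆ x))
      y∈M = x∈p∪q⁺ (inj₂ (x∈⁅x⁆ y))
      fits-M : Fits M
      fits-M = (x , x∈M) , ℕ.≤-trans (∣p∪q∣≤∣p∣+∣q∣ ⁅ x ⁆ ⁅ y ⁆)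
                 (subst₂ (λ a b → a + b ≤ suc k) (sym (∣⁅x⁆∣≡1 x)) (sym (∣⁅x⁆∣≡1 y)) (s≤s k≥1))
      C∩B⊆M : ∀ {v} → v ∈ C → v ∈ B → v ∈ M
      C∩B⊆M v∈C v∈B = ⊥-elim (disjoint (_ , x∈p∩q⁺ (v∈C , v∈B)))
      M⊆C∪B : ∀ {v} → v ∈ M → v ∈ C ⊎ v ∈ B
      M⊆C∪B v∈M = Sum.map (λ v∈⁅x⁆ → subst (_∈ C) (sym (x∈⁅y⁆⇒x≡y x v∈⁅x⁆)) x∈C)
                          (λ v∈⁅y⁆ → subst (_∈ B) (sym (x∈⁅y⁆⇒x≡y y v∈⁅y⁆)) y∈B)
                          (x∈p∪q⁻ ⁅ x ⁆ ⁅ y ⁆ v∈M)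

  record Tour (C : Subset n) (Bs : List (Subset n)) : Set where
    field
      {end}       : Subset n
      path        : Star Move C end
      ≃-bags      : C ∷ visits path ≃ C ∷ Bs
      visits-bags : All (_∈ˡ C ∷ visits path) Bs

  tour : 1 ≤ k → ∀ {C Bs} → Fits C → All Fits Bs → Tour C Bs
  tour k≥1 fits-C []                 = record { path = ε ; ≃-bags = mk≃ λ _ _ → refl ; visits-bags = [] }
  tour k≥1 fits-C (fits-B ∷ fits-Bs) = record
    { path        = path σ ◅◅ Tour.path τ
    ; ≃-bags      = ≃-◅◅ (path σ) (Tour.path τ) (≃-ends σ) (Tour.≃-bags τ)
    ; visits-bags = All.map (∈-◅◅ (path σ)) (here refl ∷ Tour.visits-bags τ)
    }
    where
      σ = segment k≥1 fits-C fits-B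
      τ = tour k≥1 fits-B fits-Bs

  visits-fit : ∀ {C B} (p : Star Move C B) → All Fits (visits p)
  visits-fit ε                = []
  visits-fit ((_ , fits) ◅ p) = fits ∷ visits-fit p

  step-at : ∀ {C B} (p : Star Move C B) (i : Fin (length (visits p))) →
            Step (lookup (C ∷ visits p) (inject₁ i)) (lookup (C ∷ visits p) (suc i))
  step-at ((step , _) ◅ p) zero    = step
  step-at (_ ◅ p)          (suc i) = step-at p i

  walk : ∀ {C B} → ∣ C ∣ ≡ 1 → Fits C → Star Move C B → SimplicialWalk k n
  walk {C} ∣C∣≡1 fits-C p = record
    { t               = length (visits p)
    ; β               = lookup (C ∷ visits p)
    ; size-pos        = nonempty⇒∣p∣≥1 ∘ proj₁ ∘ fits
    ; size-le         = proj₂ ∘ fits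
    ; first-singleton = ∣C∣≡1
    ; step            = step-at p
    }
    where
      fits : ∀ i → Fits (lookup (C ∷ visits p) i)
      fits i = All.lookup (fits-C ∷ visits-fit p) (∈-lookup i)

-- Incoming vertices are rises

module _ {k n : ℕ} (W : SimplicialWalk k n) where
  open SimplicialWalk W

  membership : Fin n → Fin (suc t) → Bool
  membership v i = v ∈ᵇ β i

  incoming⇒rise : ∀ {v} i → Incoming v i → Rise (membership v) i
  incoming⇒rise     zero    v∈β₀      = ∈⇒∈ᵇ v∈β₀
  incoming⇒rise {v} (suc i) (v∉ , β≡) =
    ∉⇒∈ᵇ≡false v∉ , ∈⇒∈ᵇ (subst (v ∈_) (sym β≡) (x∈p∪q⁺ (inj₂ (x∈⁅x⁆ v))))

  rise⇒incoming : ∀ {v} i → Rise (membership v) i → Incoming v i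
  rise⇒incoming zero r = ∈ᵇ⇒∈ r
  rise⇒incoming {v} (suc i) (v∉ , v∈) with step i
  ... | u , inj₁ (u∉ , β≡) with x∈p∪q⁻ _ ⁅ u ⁆ (subst (v ∈_) β≡ (∈ᵇ⇒∈ v∈))
  ...   | inj₁ v∈prev = ⊥-elim (∈ᵇ≡false⇒∉ v∉ v∈prev)
  ...   | inj₂ v∈⁅u⁆ rewrite x∈⁅y⁆⇒x≡y u v∈⁅u⁆ = u∉ , β≡
  rise⇒incoming {v} (suc i) (v∉ , v∈) | u , inj₂ (_ , β≡) =
    ⊥-elim (∈ᵇ≡false⇒∉ v∉ (subst (v ∈_) (sym β≡) (x∈p∪q⁺ (inj₁ (∈ᵇ⇒∈ v∈)))))

  incoming⇒∈ : ∀ {v} i → Incoming v i → v ∈ β i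
  incoming⇒∈ i inc = ∈ᵇ⇒∈ (rise⇒true _ i (incoming⇒rise i inc))

  UniqueIncoming : Fin n → Set
  UniqueIncoming v = ∃[ i ] (Incoming v i × (∀ j → Incoming v j → j ≡ i))

  uniqueIncoming⇒interval : ∀ {v} → UniqueIncoming v → Interval (membership v)
  uniqueIncoming⇒interval {v} (_ , _ , unique) = unique-rise⇒interval (membership v) λ a b ra rb →
    trans (unique a (rise⇒incoming a ra)) (sym (unique b (rise⇒incoming b rb)))

  interval⇒uniqueIncoming : ∀ {v i} → v ∈ β i → Interval (membership v) → UniqueIncoming v
  interval⇒uniqueIncoming {v} {i} v∈βi int with rise-at-or-before (membership v) i (∈⇒∈ᵇ v∈βi)
  ... | r , _ , rise = r , rise⇒incoming r rise , λ j inc →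
        interval⇒unique-rise (membership v) int j r (incoming⇒rise j inc) rise

walk⇒pathDecomposition : ∀ {k} {F : Graph} (W : SimplicialWalk k (n F)) → Decomposing F W →
                         Σ[ D ∈ PathDecomposition F ] WidthAtMost k D
walk⇒pathDecomposition W (uniqueIncoming , covered) = D , size-le
  where
    open SimplicialWalk W
    D = record
      { len             = t
      ; bag             = β
      ; edge-covered    = covered
      ; vertex-occurs   = λ v → let (i , inc , _) = uniqueIncoming v in i , incoming⇒∈ W i inc
      ; vertex-interval = λ v i j l i≤l l≤j v∈βi v∈βj → ∈ᵇ⇒∈
          (uniqueIncoming⇒interval W (uniqueIncoming v) i j l i≤l l≤j (∈⇒∈ᵇ v∈βi) (∈⇒∈ᵇ v∈βj))
      }

walk-visiting : ∀ {k n} → 1 ≤ k → ∀ {Bs X} → X ∈ˡ Bs → All (Fits k {n}) Bs →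
                (∀ v → Survives before (word v Bs)) →
                Σ[ W ∈ SimplicialWalk k n ]
                  (∀ v → Interval (membership W v)) × (∀ {X} → X ∈ˡ Bs → ∃[ i ] SimplicialWalk.β W i ≡ X)
walk-visiting {k} k≥1 {B ∷ Bs} _ (fits-B@((x , x∈B) , _) ∷ fits-Bs) survives = W , intervals , located
  where
    fits-⁅x⁆ : Fits k ⁅ x ⁆
    fits-⁅x⁆ = (x , x∈⁅x⁆ x) , subst (_≤ suc k) (sym (∣⁅x⁆∣≡1 x)) (s≤s z≤n)
    τ = tour k k≥1 fits-⁅x⁆ (fits-B ∷ fits-Bs)
    W = walk k (∣⁅x⁆∣≡1 x) fits-⁅x⁆ (Tour.path τ)
    ⁅x⁆⊆B : ∀ v → v ∈ᵇ ⁅ x ⁆ ≡ true → v ∈ᵇ B ≡ true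
    ⁅x⁆⊆B v v∈⁅x⁆ = ∈⇒∈ᵇ (subst (_∈ B) (sym (x∈⁅y⁆⇒x≡y x (∈ᵇ⇒∈ v∈⁅x⁆))) x∈B)
    intervals : ∀ v → Interval (membership W v)
    intervals v = survives-before⇒interval (membership W v)
      (subst (Survives before) (word≡tabulate v (⁅ x ⁆ ∷ visits k (Tour.path τ)))
        (≃-survives before v (Tour.≃-bags τ)
          (survives-before-prepend _ _ (word v Bs) (⁅x⁆⊆B v) (survives v))))
    located : ∀ {X} → X ∈ˡ B ∷ Bs → ∃[ i ] SimplicialWalk.β W i ≡ X
    located X∈Bs = let X∈W = All.lookup (Tour.visits-bags τ) X∈Bs in Any.index X∈W , sym (lookup-index X∈W)

pathDecomposition⇒walk : ∀ {k} → 1 ≤ k → {F : Graph} → 1 ≤ n F → (D : PathDecomposition F) →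
                         WidthAtMost k D → Σ[ W ∈ SimplicialWalk k (n F) ] Decomposing F W
pathDecomposition⇒walk {k} k≥1 {F} n≥1 D width = W , uniqueIncoming , edge-in-walk
  where
    open PathDecomposition D
    bags = filter nonempty? (tabulate bag)
    fits-bags : All (Fits k) bags
    fits-bags = All.zip ( All.all-filter nonempty? (tabulate bag)
                        , All.filter⁺ nonempty? (All.tabulate⁺ {f = bag} width))
    survives : ∀ v → Survives before (word v bags)
    survives v = survives-filter-nonempty before v (tabulate bag)
      (subst (Survives before) (sym (map-tabulate bag (v ∈ᵇ_)))
        (interval⇒survives-before (λ s → v ∈ᵇ bag s) interval))
      where
        interval : Interval (λ s → v ∈ᵇ bag s)
        interval i j l i≤l l≤j vi vj = ∈⇒∈ᵇ (vertex-interval v i j l i≤l l≤j (∈ᵇ⇒∈ vi) (∈ᵇ⇒∈ vj))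
    bag∈bags : ∀ {s v} → v ∈ bag s → bag s ∈ˡ bags
    bag∈bags {s} {v} v∈ = ∈-filter⁺ nonempty? (∈-tabulate⁺ {f = bag} s) (v , v∈)
    visiting = walk-visiting k≥1 (bag∈bags (proj₂ (vertex-occurs (fromℕ< n≥1)))) fits-bags survives
    W = proj₁ visiting
    open SimplicialWalk W
    intervals : ∀ v → Interval (membership W v)
    intervals = proj₁ (proj₂ visiting)
    located : ∀ {s v} → v ∈ bag s → ∃[ i ] β i ≡ bag s
    located v∈ = proj₂ (proj₂ visiting) (bag∈bags v∈)
    uniqueIncoming : ∀ v → UniqueIncoming W v
    uniqueIncoming v with vertex-occurs v
    ... | s , v∈ with located v∈
    ...   | i , β≡ = interval⇒uniqueIncoming W (subst (v ∈_) (sym β≡) v∈) (intervals v)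
    edge-in-walk : ∀ u v → Adj F u v → ∃[ i ] (u ∈ β i × v ∈ β i)
    edge-in-walk u v uv with edge-covered u v uv
    ... | s , u∈ , v∈ with located u∈
    ...   | i , β≡ = i , subst (u ∈_) (sym β≡) u∈ , subst (v ∈_) (sym β≡) v∈

proposition4 : (k : ℕ) → 1 ≤ k → (F : Graph) → 1 ≤ n F →
    (∃ λ (D : PathDecomposition F) → WidthAtMost k D)
      ⇔ (∃ λ (W : SimplicialWalk k (n F)) → Decomposing F W)
proposition4 k k≥1 F n≥1 = mk⇔
  (λ (D , width) → pathDecomposition⇒walk k≥1 n≥1 D width)
  (λ (W , decomposing) → walk⇒pathDecomposition W decomposing)
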